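{- Let $\Phi$ be a balanced relative simplicial complex of dimension $d$ with coloring $\kappa$, and let $\mathfrak{G}\subseteq\mathrm{Aut}(\Phi)$. Then the flag quasisymmetric class function $F(\Phi,\mathfrak{G},\mathbf{x})$ is a quasisymmetric class function, and it is $M$-increasing.
   Context: A balanced relative simplicial complex of dimension $d$ on a finite vertex set $V$ is a nonempty collection $\Phi$ of subsets of $V$ with a function $\kappa:V\to[d+1]$ such that: (1) if $\rho\subseteq\sigma\subseteq\tau$ and $\rho,\tau\in\Phi$ then $\sigma\in\Phi$; (2) every $\rho\in\Phi$ is contained in some $\sigma\in\Phi$ with $|\sigma|=d+1$; (3) for every $\rho\in\Phi$, $\kappa(\rho)=\{\kappa(v):v\in\rho\}$ has $|\rho|$ elements. An automorphism of $\Phi$ is a bijection $\mathfrak{g}:V\to V$ with $\kappa(\mathfrak{g}v)=\kappa(v)$ for all $v$ and $\mathfrak{g}\sigma\in\Phi$ for all $\sigma\in\Phi$; $\mathrm{Aut}(\Phi)$ is the group of these. For $S=\{s_1<\dots<s_k\}\subseteq[d+1]$, $\alpha(S)=(s_1,s_2-s_1,\dots,s_k-s_{k-1},d+2-s_k)$, a composition of $d+2$. With $M_\alpha$ the monomial quasisymmetric function, the flag quasisymmetric class function is defined for $\mathfrak{g}\in\mathfrak{G}$ by $F(\Phi,\mathfrak{G},\mathbf{x};\mathfrak{g})=\sum_{\sigma\in\Phi:\ \mathfrak{g}\sigma=\sigma}M_{\alpha(\kappa(\sigma))}$. A quasisymmetric class function is a function from $\mathfrak{G}$ to quasisymmetric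 functions constant on conjugacy classes. Writing $F=\sum_\alpha f_\alpha M_\alpha$ with $f_\alpha$ complex class functions, $F$ is $M$-increasing if $f_\alpha\le_{\mathfrak{G}}f_\beta$ whenever $\beta$ refines $\alpha$, where for effective characters (nonnegative integer combinations of irreducible characters) $\chi\le_{\mathfrak{G}}\psi$ means $\psi-\chi$ is effective. -}

module Defs where

open import Level using (Level; _⊔_) renaming (suc to lsuc)
open import Data.Bool using (Bool; true; false; T; _∧_; if_then_else_)
open import Data.Nat using (ℕ; zero; suc; _∸_) renaming (_+_ to _+ℕ_)
open import Data.Fin using (Fin; toℕ)
open import Data.Fin.Subset using (Subset; ⁅_⁆; ⋃; _⊆_; ∣_∣)
open import Data.List using (List; []; _∷_; map; _++_; filter; filterᵇ; length; allFin)
open import Data.List.Relation.Unary.All using (All)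
open import Data.Vec using (Vec; lookup; tabulate)
import Data.Vec.Properties as VecP
import Data.List.Properties as ListP
open import Data.Bool.Properties using () renaming (_≟_ to _≟B_)
open import Data.Nat.Properties using () renaming (_≟_ to _≟ℕ_)
open import Data.Product using (Σ; ∃; _×_)
open import Relation.Nullary using (¬_)
open import Relation.Nullary.Decidable using (⌊_⌋)
open import Relation.Binary.PropositionalEquality using (_≡_; _≢_)
open import Algebra.Bundles using (CommutativeRing)

allSubsets : (n : ℕ) → List (Subset n)
allSubsets zero    = Data.Vec.[] ∷ []
allSubsets (suc n) = map (true Data.Vec.∷_) (allSubsets n) ++ map (false Data.Vec.∷_) (allSubsets n)

image : {n m : ℕ} → (Fin n → Fin m) → Subset n → Subset m
image {n} f σ = ⋃ (map (λ v → ⁅ f v ⁆) (filterᵇ (lookup σ) (allFin n)))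

_≟S_ : {n : ℕ} → (σ τ : Subset n) → Relation.Nullary.Dec (σ ≡ τ)
_≟S_ = VecP.≡-dec _≟B_

-- Balanced relative simplicial complexes of dimension d = D - 1
-- on the vertex set V = Fin n, colours [d+1] = Fin D
-- (colour i : Fin D stands for the integer toℕ i + 1 ∈ [d+1]).

record BalancedRelComplex (n D : ℕ) : Set where
  field
    Φ        : Subset n → Bool
    κ        : Fin n → Fin D
    nonempty : ∃ λ σ → T (Φ σ)
    convex   : ∀ ρ σ τ → ρ ⊆ σ → σ ⊆ τ → T (Φ ρ) → T (Φ τ) → T (Φ σ)
    pure     : ∀ ρ → T (Φ ρ) → ∃ λ σ → ρ ⊆ σ × T (Φ σ) × ∣ σ ∣ ≡ D
    balanced : ∀ ρ → T (Φ ρ) → ∣ image κ ρ ∣ ≡ ∣ ρ ∣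

Map : ℕ → Set
Map n = Vec (Fin n) n

idMap : {n : ℕ} → Map n
idMap = tabulate (λ v → v)

_∘M_ : {n : ℕ} → Map n → Map n → Map n
g ∘M h = tabulate (λ v → lookup g (lookup h v))

act : {n : ℕ} → Map n → Subset n → Subset n
act g σ = image (lookup g) σ

record AutSubgroup {n D : ℕ} (C : BalancedRelComplex n D) : Set where
  open BalancedRelComplex C
  field
    mem      : Map n → Bool
    id∈      : T (mem idMap)
    ∘∈       : ∀ g h → T (mem g) → T (mem h) → T (mem (g ∘M h))
    inv∈     : ∀ g → T (mem g) → ∃ λ h → T (mem h) × (h ∘M g ≡ idMap)
    -- every element is an automorphism (bijectivity follows from inv∈)
    colour   : ∀ g → T (mem g) → ∀ v → κ (lookup g v) ≡ κ v
    preserve : ∀ g → T (mem g) → ∀ σ → T (Φ σ) → T (Φ (act g σ))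

-- α(S) = (s₁, s₂ - s₁, …, s_k - s_{k-1}, d+2 - s_k),  with d + 2 = suc D
private
  gaps : ℕ → ℕ → List ℕ → List ℕ
  gaps top prev []       = (top ∸ prev) ∷ []
  gaps top prev (s ∷ ss) = (s ∸ prev) ∷ gaps top s ss

elemsℕ : {D : ℕ} → Subset D → List ℕ
elemsℕ {D} S = map (λ i → suc (toℕ i)) (filterᵇ (lookup S) (allFin D))

α : {D : ℕ} → Subset D → List ℕ
α {D} S = gaps (suc D) 0 (elemsℕ S)

IsComposition : List ℕ → Set
IsComposition = All (λ a → 1 Data.Nat.≤ a)

data _Refines_ : List ℕ → List ℕ → Set where
  []    : [] Refines []
  keep  : ∀ {b β γ} → β Refines γ → (b ∷ β) Refines (b ∷ γ)
  merge : ∀ {c b a β γ} → (b ∷ β) Refines (a ∷ γ) → (c ∷ b ∷ β) Refines ((c +ℕ a) ∷ γ)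

-- Coefficients of the flag quasisymmetric class function
--   F(Φ,𝔊,x;g) = Σ_{σ ∈ Φ, gσ = σ} M_{α(κ(σ))} = Σ_γ f_γ(g) M_γ
-- so  f_γ(g) = #{ σ ∈ Φ : gσ = σ, α(κ(σ)) = γ }.

flagCoeff : {n D : ℕ} → BalancedRelComplex n D → List ℕ → Map n → ℕ
flagCoeff {n} C γ g =
  length (filterᵇ (λ σ → Φ σ ∧ ⌊ act g σ ≟S σ ⌋ ∧ ⌊ ListP.≡-dec _≟ℕ_ (α (image κ σ)) γ ⌋)
                  (allSubsets n))
  where open BalancedRelComplex C

IsClassFunction : {n D : ℕ} {C : BalancedRelComplex n D} → AutSubgroup C → (Map n → ℕ) → Set
IsClassFunction {n} G f =
  ∀ g h h' → T (mem g) → T (mem h) → T (mem h') → h' ∘M h ≡ idMap → f (h ∘M (g ∘M h')) ≡ f g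
  where open AutSubgroup G

module RingOps {c ℓ : Level} (R : CommutativeRing c ℓ) where
  open CommutativeRing R
  ι : ℕ → Carrier
  ι zero    = 0#
  ι (suc k) = 1# + ι k
  -- evaluate the monic polynomial x^(k+1) + c₀ x^k + … + c_k  at x
  monicEval : Carrier → List Carrier → Carrier
  monicEval x cs = Data.List.foldl (λ acc a → acc * x + a) 1# cs

record AlgClosedChar0Field (c ℓ : Level) : Set (lsuc (c ⊔ ℓ)) where
  field
    cring : CommutativeRing c ℓ
  open CommutativeRing cring public
  open RingOps cring public
  field
    1≉0        : ¬ (1# ≈ 0#)
    inverse    : ∀ x → ¬ (x ≈ 0#) → ∃ λ y → x * y ≈ 1#
    char0      : ∀ k → ¬ (ι (suc k) ≈ 0#)
    algClosed  : ∀ a as → ∃ λ x → monicEval x (a ∷ as) ≈ 0#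

module _ {c ℓ : Level} (K : AlgClosedChar0Field c ℓ) where
  open AlgClosedChar0Field K

  Mat : ℕ → Set c
  Mat m = Fin m → Fin m → Carrier

  sumF : {m : ℕ} → (Fin m → Carrier) → Carrier
  sumF {zero}  f = 0#
  sumF {suc m} f = f Data.Fin.zero + sumF (λ i → f (Data.Fin.suc i))

  _⊛_ : {m : ℕ} → Mat m → Mat m → Mat m
  (A ⊛ B) i j = sumF (λ k → A i k * B k j)

  idMat : {m : ℕ} → Mat m
  idMat i j = if ⌊ i Data.Fin.≟ j ⌋ then 1# else 0#

  _≈M_ : {m : ℕ} → Mat m → Mat m → Set ℓ
  A ≈M B = ∀ i j → A i j ≈ B i j

  trace : {m : ℕ} → Mat m → Carrier
  trace A = sumF (λ i → A i i)

  record Rep {n D : ℕ} {C : BalancedRelComplex n D} (G : AutSubgroup C) : Set (c ⊔ ℓ) where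
    open AutSubgroup G
    field
      dim   : ℕ
      ρ     : Map n → Mat dim
      ρ-id  : ρ idMap ≈M idMat
      ρ-hom : ∀ g h → T (mem g) → T (mem h) → ρ (g ∘M h) ≈M (ρ g ⊛ ρ h)

  -- χ ≤_𝔊 ψ  :  ψ - χ is an effective character, i.e. the character of some
  -- (possibly zero) representation:  trace ρ(g) + χ(g) = ψ(g) for g ∈ 𝔊
  ≤G : {n D : ℕ} {C : BalancedRelComplex n D} → AutSubgroup C → (χ ψ : Map n → ℕ) → Set (c ⊔ ℓ)
  ≤G G χ ψ = Σ (Rep G) λ R → ∀ g → T (AutSubgroup.mem G g) →
               trace (Rep.ρ R g) + ι (χ g) ≈ ι (ψ g)

module Submission where

-- f_γ(g) is the number of faces of type γ (faces σ ∈ Φ with α(κ σ) = γ) fixed by g, i.e. the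
-- permutation character of 𝔊 on the 𝔊-stable family Φ_γ; a count of fixed points of a
-- 𝔊-stable family is a class function.
--
-- For monotonicity let β refine γ. If γ = α U, then β = α V with U ⊆ V. Keeping only the
-- vertices with colours in U sends a face of type β to a set that, when it lies in Φ, is a face
-- of type γ; this gives a 𝔊-equivariant linear map K[Φ_β] → K[Φ_γ] (faces leaving Φ go to 0).
-- It is onto, because a face y of type γ has the preimage obtained by adding to y the vertices
-- with colours in V ∖ U of a facet containing y; by convexity and balancedness that is a face of
-- type β. The kernel of this map is a representation with character f_β − f_γ. If γ is not of
-- the form α U there are no faces of type γ, so f_γ = 0 and the same kernel argument applies with
-- the zero map.

open import Defs
open import Algebra.Bundles using (CommutativeSemiring; CommutativeRing)
open import Data.Bool using (Bool; true; false; T; not; _∧_; if_then_else_)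
open import Data.Bool.Properties using (T-≡; T-∧; ∧-assoc; ∧-comm)
open import Data.Empty using (⊥-elim)
open import Data.Fin using (Fin; toℕ)
import Data.Fin as Fin
open import Data.Fin.Subset using (Subset; _∈_; _⊆_; _∪_; _∩_; ∁; ⊤; ⁅_⁆; ⋃; ∣_∣; inside; outside)
open import Data.Fin.Subset.Properties
  using ( ∉⊥; ∈⊤; x∈⁅x⁆; x∈⁅y⁆⇒x≡y; x∈p∪q⁻; x∈p∪q⁺; x∈p∩q⁻; x∈p∩q⁺; x∉p⇒x∈∁p; x∈∁p⇒x∉p
        ; ⊆-antisym; ∣p∣≡n⇒p≡⊤; _∈?_; anySubset?)
open import Data.List using (List; []; _∷_; map; filterᵇ; length; foldr; allFin; _++_)
import Data.List as List
open import Data.List.Membership.Propositional using () renaming (_∈_ to _∈ₗ_)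
open import Data.List.Membership.Propositional.Properties using (∈-filter⁺; ∈-filter⁻; ∈-allFin; ∈-lookup; ∈-map⁻)
open import Data.List.Properties using (map-cong; map-tabulate; map-∘; map-++; ∷-injectiveʳ; filter-≐)
import Data.List.Properties as ListP
open import Data.List.Relation.Binary.Disjoint.Propositional using (Disjoint)
open import Data.List.Relation.Unary.All using ([]; _∷_) renaming (tail to All-tail)
import Data.List.Relation.Unary.All as All
open import Data.List.Relation.Unary.AllPairs using ([]; _∷_)
open import Data.List.Relation.Unary.Any using (here; there)
open import Data.List.Relation.Unary.Unique.Propositional using (Unique)
open import Data.List.Relation.Unary.Unique.Propositional.Properties using (++⁺; map⁺; filter⁺)
open import Data.Nat using (ℕ; zero; suc; _∸_; _≤_; z≤n; s≤s)
open import Data.Nat.Properties using (≤-refl; ≤-trans; m≤m+n; +-*-commutativeSemiring) renaming (_≟_ to _≟ℕ_)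
open import Data.Product using (∃; _×_; _,_; proj₁; proj₂)
open import Data.Sum using (_⊎_; inj₁; inj₂)
open import Data.Vec using ([]; _∷_; lookup; tabulate; here; there)
open import Data.Vec.Properties using (lookup∘tabulate; []=⇒lookup; lookup⇒[]=) renaming (∷-injectiveʳ to Vec-∷-injectiveʳ)
open import Function using (_∘_; id; _⇔_; mk⇔; Equivalence)
open import Level using (Level)
open import Relation.Binary.Definitions using (DecidableEquality)
open import Relation.Binary.PropositionalEquality using (_≡_; _≢_; refl; sym; trans; cong; cong₂; subst; subst₂; module ≡-Reasoning)
open import Relation.Nullary using (Dec; yes; no; does; ¬_; contradiction)
open import Relation.Nullary.Decidable using (⌊_⌋; T?; toWitness; fromWitness; isYes≗does; does-⇔; dec-false)

private
  variable
    n m D : ℕ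
    β γ : List ℕ

T⇔T⇒≡ : ∀ {x y} → (T x → T y) → (T y → T x) → x ≡ y
T⇔T⇒≡ {false} {false} _   _   = refl
T⇔T⇒≡ {false} {true}  _   y⇒x = ⊥-elim (y⇒x _)
T⇔T⇒≡ {true}  {false} x⇒y _   = ⊥-elim (x⇒y _)
T⇔T⇒≡ {true}  {true}  _   _   = refl

T-not⇒¬T : ∀ {x} → T (not x) → ¬ T x
T-not⇒¬T {false} _ ()

⌊⌋-⇔ : {A B : Set} → A ⇔ B → (a? : Dec A) (b? : Dec B) → ⌊ a? ⌋ ≡ ⌊ b? ⌋
⌊⌋-⇔ A⇔B a? b? = trans (isYes≗does a?) (trans (does-⇔ A⇔B a? b?) (sym (isYes≗does b?)))

filterᵇ-map : ∀ {A B : Set} (p : B → Bool) (f : A → B) xs → filterᵇ p (map f xs) ≡ map f (filterᵇ (p ∘ f) xs)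
filterᵇ-map p f []       = refl
filterᵇ-map p f (x ∷ xs) with p (f x)
... | true  = cong (f x ∷_) (filterᵇ-map p f xs)
... | false = filterᵇ-map p f xs

length-filterᵇ-cong : ∀ {A : Set} {p q : A → Bool} → (∀ x → p x ≡ q x) → ∀ xs →
                      length (filterᵇ p xs) ≡ length (filterᵇ q xs)
length-filterᵇ-cong {p = p} {q} p≗q xs =
  cong length (filter-≐ (T? ∘ p) (T? ∘ q) ((λ {x} → subst T (p≗q x)) , (λ {x} → subst T (sym (p≗q x)))) xs)

Unique-lookup-injective : ∀ {A : Set} {xs : List A} → Unique xs → ∀ i j → List.lookup xs i ≡ List.lookup xs j → i ≡ j
Unique-lookup-injective (_ ∷ _)   Fin.zero    Fin.zero    _ = refl
Unique-lookup-injective (x≢ ∷ _)  Fin.zero    (Fin.suc j) e = contradiction e (All.lookup x≢ (∈-lookup j))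
Unique-lookup-injective (x≢ ∷ _)  (Fin.suc i) Fin.zero    e = contradiction (sym e) (All.lookup x≢ (∈-lookup i))
Unique-lookup-injective (_ ∷ xs!) (Fin.suc i) (Fin.suc j) e = cong Fin.suc (Unique-lookup-injective xs! i j e)

-- Images and preimages of subsets

T-lookup⇒∈ : {p : Subset n} {x : Fin n} → T (lookup p x) → x ∈ p
T-lookup⇒∈ {p = p} {x} t = lookup⇒[]= x p (Equivalence.to T-≡ t)

∈⇒T-lookup : {p : Subset n} {x : Fin n} → x ∈ p → T (lookup p x)
∈⇒T-lookup x∈p = Equivalence.from T-≡ ([]=⇒lookup x∈p)

module _ {n m : ℕ} (f : Fin n → Fin m) where

  ∈-⋃-singletons⁻ : ∀ {y} us → y ∈ ⋃ (map (λ u → ⁅ f u ⁆) us) → ∃ λ u → u ∈ₗ us × f u ≡ y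
  ∈-⋃-singletons⁻ []       y∈ = ⊥-elim (∉⊥ y∈)
  ∈-⋃-singletons⁻ (u ∷ us) y∈ with x∈p∪q⁻ ⁅ f u ⁆ _ y∈
  ... | inj₁ y∈⁅fu⁆ = u , here refl , sym (x∈⁅y⁆⇒x≡y (f u) y∈⁅fu⁆)
  ... | inj₂ y∈⋃    = let u′ , u′∈us , fu′≡y = ∈-⋃-singletons⁻ us y∈⋃ in u′ , there u′∈us , fu′≡y

  ∈-⋃-singletons⁺ : ∀ {u} us → u ∈ₗ us → f u ∈ ⋃ (map (λ u → ⁅ f u ⁆) us)
  ∈-⋃-singletons⁺ (u ∷ _)  (here refl)  = x∈p∪q⁺ (inj₁ (x∈⁅x⁆ (f u)))
  ∈-⋃-singletons⁺ (_ ∷ us) (there u∈us) = x∈p∪q⁺ (inj₂ (∈-⋃-singletons⁺ us u∈us))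

  ∈-image⁻ : ∀ {σ y} → y ∈ image f σ → ∃ λ x → x ∈ σ × f x ≡ y
  ∈-image⁻ {σ} y∈ with ∈-⋃-singletons⁻ (filterᵇ (lookup σ) (allFin n)) y∈
  ... | x , x∈ , fx≡y = x , T-lookup⇒∈ (proj₂ (∈-filter⁻ (T? ∘ lookup σ) {xs = allFin n} x∈)) , fx≡y

  ∈-image⁺ : ∀ {σ x} → x ∈ σ → f x ∈ image f σ
  ∈-image⁺ {σ} {x} x∈σ =
    ∈-⋃-singletons⁺ (filterᵇ (lookup σ) (allFin n)) (∈-filter⁺ (T? ∘ lookup σ) (∈-allFin x) (∈⇒T-lookup x∈σ))

image-cong : {f g : Fin n → Fin m} → (∀ x → f x ≡ g x) → ∀ σ → image f σ ≡ image g σ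
image-cong {n} f≗g σ = cong ⋃ (map-cong (cong ⁅_⁆ ∘ f≗g) (filterᵇ (lookup σ) (allFin n)))

image-id : (σ : Subset n) → image id σ ≡ σ
image-id σ = ⊆-antisym sub (∈-image⁺ id {σ})
  where
  sub : image id σ ⊆ σ
  sub y∈ with ∈-image⁻ id {σ} y∈
  ... | _ , x∈σ , refl = x∈σ

image-∘ : ∀ {k} (f : Fin m → Fin k) (g : Fin n → Fin m) σ → image f (image g σ) ≡ image (f ∘ g) σ
image-∘ f g σ = ⊆-antisym sub sup
  where
  sub : image f (image g σ) ⊆ image (f ∘ g) σ
  sub z∈ with ∈-image⁻ f {image g σ} z∈
  ... | _ , y∈ , refl with ∈-image⁻ g {σ} y∈
  ... | _ , x∈σ , refl = ∈-image⁺ (f ∘ g) {σ} x∈σ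
  sup : image (f ∘ g) σ ⊆ image f (image g σ)
  sup z∈ with ∈-image⁻ (f ∘ g) {σ} z∈
  ... | _ , x∈σ , refl = ∈-image⁺ f {image g σ} (∈-image⁺ g {σ} x∈σ)

preimage : (Fin n → Fin m) → Subset m → Subset n
preimage f S = tabulate (λ x → lookup S (f x))

module _ {n m : ℕ} {f : Fin n → Fin m} {S : Subset m} where

  ∈-preimage⁺ : ∀ {x} → f x ∈ S → x ∈ preimage f S
  ∈-preimage⁺ {x} fx∈S = lookup⇒[]= x _ (trans (lookup∘tabulate _ x) ([]=⇒lookup fx∈S))

  ∈-preimage⁻ : ∀ {x} → x ∈ preimage f S → f x ∈ S
  ∈-preimage⁻ {x} x∈ = lookup⇒[]= (f x) S (trans (sym (lookup∘tabulate _ x)) ([]=⇒lookup x∈))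

image-∩-preimage : ∀ {k} (κ : Fin n → Fin k) {f : Fin n → Fin n} → (∀ x → κ (f x) ≡ κ x) →
                   ∀ σ S → image f (σ ∩ preimage κ S) ≡ image f σ ∩ preimage κ S
image-∩-preimage κ {f} κ∘f≗κ σ S = ⊆-antisym sub sup
  where
  sub : image f (σ ∩ preimage κ S) ⊆ image f σ ∩ preimage κ S
  sub z∈ with ∈-image⁻ f {σ ∩ preimage κ S} z∈
  ... | x , x∈ , refl with x∈p∩q⁻ σ _ x∈
  ... | x∈σ , x∈κ⁻¹S =
    x∈p∩q⁺ (∈-image⁺ f {σ} x∈σ , ∈-preimage⁺ (subst (_∈ S) (sym (κ∘f≗κ x)) (∈-preimage⁻ x∈κ⁻¹S)))
  sup : image f σ ∩ preimage κ S ⊆ image f (σ ∩ preimage κ S)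
  sup z∈ with x∈p∩q⁻ (image f σ) _ z∈
  ... | z∈fσ , z∈κ⁻¹S with ∈-image⁻ f {σ} z∈fσ
  ... | x , x∈σ , refl =
    ∈-image⁺ f {σ ∩ preimage κ S} (x∈p∩q⁺ (x∈σ , ∈-preimage⁺ (subst (_∈ S) (κ∘f≗κ x) (∈-preimage⁻ z∈κ⁻¹S))))

allSubsets-unique : ∀ n → Unique (allSubsets n)
allSubsets-unique zero    = [] ∷ []
allSubsets-unique (suc n) =
  ++⁺ (map⁺ Vec-∷-injectiveʳ (allSubsets-unique n)) (map⁺ Vec-∷-injectiveʳ (allSubsets-unique n)) disjoint
  where
  disjoint : Disjoint (map (inside ∷_) (allSubsets n)) (map (outside ∷_) (allSubsets n))
  disjoint (x∈ , x∈′) with ∈-map⁻ (inside ∷_) x∈ | ∈-map⁻ (outside ∷_) x∈′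
  ... | _ , _ , refl | _ , _ , ()

act-∘M : (g h : Map n) (σ : Subset n) → act (g ∘M h) σ ≡ act g (act h σ)
act-∘M g h σ = trans (image-cong (lookup∘tabulate _) σ) (sym (image-∘ (lookup g) (lookup h) σ))

act-idMap : (σ : Subset n) → act idMap σ ≡ σ
act-idMap σ = trans (image-cong (lookup∘tabulate id) σ) (image-id σ)

act-inverse : (g h : Map n) → h ∘M g ≡ idMap → ∀ σ → act h (act g σ) ≡ σ
act-inverse g h h∘g≡id σ = trans (sym (act-∘M h g σ)) (trans (cong (λ k → act k σ) h∘g≡id) (act-idMap σ))

-- Compositions

incHead : List ℕ → List ℕ
incHead []      = []
incHead (a ∷ l) = suc a ∷ l

subHead : ℕ → List ℕ → List ℕ
subHead p []      = []
subHead p (a ∷ l) = (a ∸ p) ∷ l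

firstGap : Subset D → ℕ
firstGap []          = 0
firstGap (true ∷ _)  = 0
firstGap (false ∷ S) = suc (firstGap S)

laterGaps : Subset D → List ℕ

gapsOf : Subset D → List ℕ
gapsOf S = suc (firstGap S) ∷ laterGaps S

laterGaps []          = []
laterGaps (true ∷ S)  = gapsOf S
laterGaps (false ∷ S) = laterGaps S

-- Defs.α is defined through a private function; gaps′ is a copy of it that can be reasoned about.
gaps′ : ℕ → ℕ → List ℕ → List ℕ
gaps′ top prev []       = (top ∸ prev) ∷ []
gaps′ top prev (s ∷ ss) = (s ∸ prev) ∷ gaps′ top s ss

gaps′-shift : ∀ t p l → gaps′ (suc t) (suc p) (map suc l) ≡ gaps′ t p l
gaps′-shift t p []      = refl
gaps′-shift t p (s ∷ l) = cong ((s ∸ p) ∷_) (gaps′-shift t s l)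

gaps′-incHead : ∀ t l → gaps′ (suc t) 0 (map suc l) ≡ incHead (gaps′ t 0 l)
gaps′-incHead t []      = refl
gaps′-incHead t (s ∷ l) = cong (suc s ∷_) (gaps′-shift t s l)

gaps′-subHead : ∀ t p l → gaps′ t p l ≡ subHead p (gaps′ t 0 l)
gaps′-subHead t p []      = refl
gaps′-subHead t p (_ ∷ _) = refl

elemsℕ-tail : (b : Bool) (S : Subset D) →
  map (suc ∘ toℕ) (filterᵇ (lookup (b ∷ S)) (List.tabulate Fin.suc)) ≡ map suc (elemsℕ S)
elemsℕ-tail {D} b S = begin
  map (suc ∘ toℕ) (filterᵇ (lookup (b ∷ S)) (List.tabulate Fin.suc))
    ≡⟨ cong (map (suc ∘ toℕ) ∘ filterᵇ (lookup (b ∷ S))) (sym (map-tabulate id Fin.suc)) ⟩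
  map (suc ∘ toℕ) (filterᵇ (lookup (b ∷ S)) (map Fin.suc (allFin D)))
    ≡⟨ cong (map (suc ∘ toℕ)) (filterᵇ-map (lookup (b ∷ S)) Fin.suc (allFin D)) ⟩
  map (suc ∘ toℕ) (map Fin.suc (filterᵇ (lookup S) (allFin D)))
    ≡⟨ sym (map-∘ _) ⟩
  map (suc ∘ suc ∘ toℕ) (filterᵇ (lookup S) (allFin D))
    ≡⟨ map-∘ _ ⟩
  map suc (elemsℕ S) ∎
  where open ≡-Reasoning

elemsℕ-inside : (S : Subset D) → elemsℕ (inside ∷ S) ≡ 1 ∷ map suc (elemsℕ S)
elemsℕ-inside S = cong (1 ∷_) (elemsℕ-tail true S)

elemsℕ-outside : (S : Subset D) → elemsℕ (outside ∷ S) ≡ map suc (elemsℕ S)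
elemsℕ-outside S = elemsℕ-tail false S

elemsℕ-dropFirst : ∀ {x L} (S : Subset D) → elemsℕ S ≡ x ∷ L → ∃ λ (S′ : Subset D) → elemsℕ S′ ≡ L
elemsℕ-dropFirst (true ∷ S) e =
  false ∷ S , trans (elemsℕ-outside S) (∷-injectiveʳ (trans (sym (elemsℕ-inside S)) e))
elemsℕ-dropFirst (false ∷ S) e with elemsℕ S in eS | trans (sym (elemsℕ-outside S)) e
... | _ ∷ _ | refl = let S′ , e′ = elemsℕ-dropFirst S eS in false ∷ S′ , trans (elemsℕ-outside S′) (cong (map suc) e′)

α-dropFirst : ∀ {x L} (S S′ : Subset D) → elemsℕ S ≡ x ∷ L → elemsℕ S′ ≡ L → α S ≡ x ∷ subHead x (α S′)
α-dropFirst {L = []}    _ _ e e′ rewrite e | e′ = refl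
α-dropFirst {L = _ ∷ _} _ _ e e′ rewrite e | e′ = refl

α≡gaps′ : ∀ L (S : Subset D) → elemsℕ S ≡ L → α S ≡ gaps′ (suc D) 0 L
α≡gaps′ [] S e rewrite e = refl
α≡gaps′ {D} (x ∷ L) S e with elemsℕ-dropFirst S e
... | S′ , e′ = begin
  α S                                ≡⟨ α-dropFirst S S′ e e′ ⟩
  x ∷ subHead x (α S′)               ≡⟨ cong (λ l → x ∷ subHead x l) (α≡gaps′ L S′ e′) ⟩
  x ∷ subHead x (gaps′ (suc D) 0 L)  ≡⟨ cong (x ∷_) (gaps′-subHead (suc D) x L) ⟨
  gaps′ (suc D) 0 (x ∷ L)            ∎
  where open ≡-Reasoning

gaps′≡gapsOf : (S : Subset D) → gaps′ (suc D) 0 (elemsℕ S) ≡ gapsOf S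
gaps′≡gapsOf []                  = refl
gaps′≡gapsOf {suc D} (true ∷ S)  = begin
  gaps′ (suc (suc D)) 0 (elemsℕ (true ∷ S))      ≡⟨ cong (gaps′ (suc (suc D)) 0) (elemsℕ-inside S) ⟩
  1 ∷ gaps′ (suc (suc D)) 1 (map suc (elemsℕ S)) ≡⟨ cong (1 ∷_) (gaps′-shift (suc D) 0 (elemsℕ S)) ⟩
  1 ∷ gaps′ (suc D) 0 (elemsℕ S)                 ≡⟨ cong (1 ∷_) (gaps′≡gapsOf S) ⟩
  1 ∷ gapsOf S                                    ∎
  where open ≡-Reasoning
gaps′≡gapsOf {suc D} (false ∷ S) = begin
  gaps′ (suc (suc D)) 0 (elemsℕ (false ∷ S))     ≡⟨ cong (gaps′ (suc (suc D)) 0) (elemsℕ-outside S) ⟩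
  gaps′ (suc (suc D)) 0 (map suc (elemsℕ S))     ≡⟨ gaps′-incHead (suc D) (elemsℕ S) ⟩
  incHead (gaps′ (suc D) 0 (elemsℕ S))           ≡⟨ cong incHead (gaps′≡gapsOf S) ⟩
  incHead (gapsOf S)                              ∎
  where open ≡-Reasoning

α≡gapsOf : (S : Subset D) → α S ≡ gapsOf S
α≡gapsOf S = trans (α≡gaps′ (elemsℕ S) S refl) (gaps′≡gapsOf S)

Refines-refl : ∀ β → β Refines β
Refines-refl []      = []
Refines-refl (b ∷ β) = keep (Refines-refl β)

Refines-head≤ : ∀ {a b} → (b ∷ β) Refines (a ∷ γ) → b ≤ a
Refines-head≤ (keep _)  = ≤-refl
Refines-head≤ (merge _) = m≤m+n _ _

Refines-pred : ∀ {a b} → (suc b ∷ β) Refines (suc a ∷ γ) → (b ∷ β) Refines (a ∷ γ)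
Refines-pred (keep r)  = keep r
Refines-pred (merge r) = merge r

Refines-1∷ : ∀ {a} → (1 ∷ β) Refines (suc a ∷ γ) → (a ≡ 0 × β Refines γ) ⊎ β Refines (a ∷ γ)
Refines-1∷ (keep r)  = inj₁ (refl , r)
Refines-1∷ (merge r) = inj₂ r

¬Refines-0∷ : IsComposition β → ¬ β Refines (0 ∷ γ)
¬Refines-0∷ (1≤b ∷ _) r with () ← ≤-trans 1≤b (Refines-head≤ r)

Refines-1∷-composition : IsComposition β → β Refines (1 ∷ γ) → ∃ λ β′ → β ≡ 1 ∷ β′ × β′ Refines γ
Refines-1∷-composition {β = 1 ∷ β′} (_ ∷ comp) r with Refines-1∷ r
... | inj₁ (_ , r′) = β′ , refl , r′
... | inj₂ r′       = contradiction r′ (¬Refines-0∷ comp)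
Refines-1∷-composition {β = suc (suc _) ∷ _} _ r with s≤s () ← Refines-head≤ r

Refines⇒⊆ : (S S′ : Subset D) → gapsOf S′ Refines gapsOf S → S ⊆ S′
Refines⇒⊆ (true ∷ S)  (true ∷ S′)  r         here        = here
Refines⇒⊆ (true ∷ S)  (true ∷ S′)  (keep r)  (there x∈S) = there (Refines⇒⊆ S S′ r x∈S)
Refines⇒⊆ (true ∷ S)  (true ∷ S′)  (merge r) _ with () ← Refines-head≤ r
Refines⇒⊆ (true ∷ S)  (false ∷ S′) r         _ with s≤s () ← Refines-head≤ r
Refines⇒⊆ (false ∷ S) (true ∷ S′)  r         (there x∈S) with Refines-1∷ r
... | inj₂ r′ = there (Refines⇒⊆ S S′ r′ x∈S)
Refines⇒⊆ (false ∷ S) (false ∷ S′) r         (there x∈S) = there (Refines⇒⊆ S S′ (Refines-pred r) x∈S)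

Refines-gapsOf : (S : Subset D) → IsComposition β → β Refines gapsOf S → ∃ λ (S′ : Subset D) → gapsOf S′ ≡ β
Refines-gapsOf [] comp r with Refines-1∷-composition comp r
... | _ , refl , [] = [] , refl
Refines-gapsOf (true ∷ S) comp r with Refines-1∷-composition comp r
... | _ , refl , r′ with Refines-gapsOf S (All-tail comp) r′
...   | S′ , e = true ∷ S′ , cong (1 ∷_) e
Refines-gapsOf {β = 1 ∷ _} (false ∷ S) (_ ∷ comp) r with Refines-1∷ r
... | inj₂ r′ with Refines-gapsOf S comp r′
...   | S′ , e = true ∷ S′ , cong (1 ∷_) e
Refines-gapsOf {β = suc (suc _) ∷ _} (false ∷ S) (_ ∷ comp) r with Refines-gapsOf S (s≤s z≤n ∷ comp) (Refines-pred r)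
... | S′ , e = false ∷ S′ , cong incHead e

α-injective : {S₁ S₂ : Subset D} → α S₁ ≡ α S₂ → S₁ ≡ S₂
α-injective {S₁ = S₁} {S₂} e = ⊆-antisym (Refines⇒⊆ S₁ S₂ (subst (_Refines gapsOf S₁) e′ (Refines-refl _)))
                                          (Refines⇒⊆ S₂ S₁ (subst (gapsOf S₁ Refines_) e′ (Refines-refl _)))
  where
  e′ : gapsOf S₁ ≡ gapsOf S₂
  e′ = trans (sym (α≡gapsOf S₁)) (trans e (α≡gapsOf S₂))

-- Sums over all subsets of a finite set

module SubsetSums {c ℓ : Level} (R : CommutativeSemiring c ℓ) where

  open CommutativeSemiring R hiding (refl; sym; trans; reflexive)
  private module ≈ = CommutativeSemiring R using (refl; sym; trans; reflexive)
  open import Algebra.Properties.CommutativeSemigroup +-commutativeSemigroup using (interchange)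
  open import Relation.Binary.Reasoning.Setoid setoid

  ∑ : (Subset n → Carrier) → Carrier
  ∑ {zero}  f = f []
  ∑ {suc n} f = ∑ (λ x → f (inside ∷ x)) + ∑ (λ x → f (outside ∷ x))

  [_] : Bool → Carrier
  [ b ] = if b then 1# else 0#

  δ : Subset n → Subset n → Carrier
  δ x y = [ does (x ≟S y) ]

  fromℕ : ℕ → Carrier
  fromℕ zero    = 0#
  fromℕ (suc k) = 1# + fromℕ k

  [T] : ∀ {b} → T b → [ b ] ≈ 1#
  [T] {true} _ = ≈.refl

  [∧] : ∀ x y → [ x ∧ y ] ≈ [ x ] * [ y ]
  [∧] true  y = ≈.sym (*-identityˡ _)
  [∧] false y = ≈.sym (zeroˡ _)

  []-*-cong : ∀ b {u v} → (T b → u ≈ v) → [ b ] * u ≈ [ b ] * v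
  []-*-cong true  u≈v = *-cong ≈.refl (u≈v _)
  []-*-cong false _   = ≈.trans (zeroˡ _) (≈.sym (zeroˡ _))

  δ≡[⌊≟S⌋] : (x y : Subset n) → δ x y ≡ [ ⌊ y ≟S x ⌋ ]
  δ≡[⌊≟S⌋] x y = cong [_] (trans (does-⇔ (mk⇔ sym sym) (x ≟S y) (y ≟S x)) (sym (isYes≗does (y ≟S x))))

  δ-≢ : {x y : Subset n} → x ≢ y → δ x y ≡ 0#
  δ-≢ {x = x} {y} x≢y = cong [_] (dec-false (x ≟S y) x≢y)

  ∑-cong : {f g : Subset n → Carrier} → (∀ x → f x ≈ g x) → ∑ f ≈ ∑ g
  ∑-cong {zero}  f≈g = f≈g []
  ∑-cong {suc n} f≈g = +-cong (∑-cong (λ x → f≈g (inside ∷ x))) (∑-cong (λ x → f≈g (outside ∷ x)))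

  ∑-distrib-+ : (f g : Subset n → Carrier) → ∑ (λ x → f x + g x) ≈ ∑ f + ∑ g
  ∑-distrib-+ {zero}  f g = ≈.refl
  ∑-distrib-+ {suc n} f g =
    ≈.trans (+-cong (∑-distrib-+ (λ x → f (inside ∷ x)) (λ x → g (inside ∷ x)))
                    (∑-distrib-+ (λ x → f (outside ∷ x)) (λ x → g (outside ∷ x))))
            (interchange _ _ _ _)

  *-distribˡ-∑ : ∀ a (f : Subset n → Carrier) → a * ∑ f ≈ ∑ (λ x → a * f x)
  *-distribˡ-∑ {zero}  a f = ≈.refl
  *-distribˡ-∑ {suc n} a f =
    ≈.trans (distribˡ a _ _) (+-cong (*-distribˡ-∑ a (λ x → f (inside ∷ x))) (*-distribˡ-∑ a (λ x → f (outside ∷ x))))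

  ∑-zero : ∑ {n} (λ _ → 0#) ≈ 0#
  ∑-zero {zero}  = ≈.refl
  ∑-zero {suc n} = ≈.trans (+-cong (∑-zero {n}) (∑-zero {n})) (+-identityʳ 0#)

  ∑-comm : ∀ {m} (F : Subset n → Subset m → Carrier) → ∑ (λ x → ∑ (λ y → F x y)) ≈ ∑ (λ y → ∑ (λ x → F x y))
  ∑-comm {zero}  F = ≈.refl
  ∑-comm {suc n} F =
    ≈.trans (+-cong (∑-comm (λ x → F (inside ∷ x))) (∑-comm (λ x → F (outside ∷ x))))
            (≈.sym (∑-distrib-+ (λ y → ∑ (λ x → F (inside ∷ x) y)) (λ y → ∑ (λ x → F (outside ∷ x) y))))

  ∑-δ : (f : Subset n → Carrier) (w : Subset n) → ∑ (λ x → f x * δ x w) ≈ f w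
  ∑-δ {zero}  f []          = *-identityʳ (f [])
  ∑-δ {suc n} f (true ∷ w)  =
    ≈.trans (+-cong (∑-δ (λ x → f (inside ∷ x)) w) (≈.trans (∑-cong {n} (λ x → zeroʳ (f (outside ∷ x)))) (∑-zero {n})))
            (+-identityʳ _)
  ∑-δ {suc n} f (false ∷ w) =
    ≈.trans (+-cong (≈.trans (∑-cong {n} (λ x → zeroʳ (f (inside ∷ x)))) (∑-zero {n})) (∑-δ (λ x → f (outside ∷ x)) w))
            (+-identityˡ _)

  ∑-reindex : (φ ψ : Subset n → Subset n) → (∀ x → ψ (φ x) ≡ x) → (∀ y → φ (ψ y) ≡ y) →
              (f : Subset n → Carrier) → ∑ (λ x → f (φ x)) ≈ ∑ f
  ∑-reindex φ ψ ψ∘φ φ∘ψ f = begin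
    ∑ (λ x → f (φ x))                      ≈⟨ ∑-cong (λ x → ≈.sym (∑-δ f (φ x))) ⟩
    ∑ (λ x → ∑ (λ y → f y * δ y (φ x)))    ≈⟨ ∑-comm (λ x y → f y * δ y (φ x)) ⟩
    ∑ (λ y → ∑ (λ x → f y * δ y (φ x)))    ≈⟨ ∑-cong (λ y → ≈.sym (*-distribˡ-∑ (f y) (λ x → δ y (φ x)))) ⟩
    ∑ (λ y → f y * ∑ (λ x → δ y (φ x)))    ≈⟨ ∑-cong (λ y → *-cong ≈.refl (∑-δ-φ y)) ⟩
    ∑ (λ y → f y * 1#)                     ≈⟨ ∑-cong (λ y → *-identityʳ (f y)) ⟩
    ∑ f                                    ∎
    where
    y≡φx⇔x≡ψy : ∀ x y → (y ≡ φ x) ⇔ (x ≡ ψ y)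
    y≡φx⇔x≡ψy x y = mk⇔ (λ { refl → sym (ψ∘φ x) }) (λ { refl → sym (φ∘ψ y) })
    ∑-δ-φ : ∀ y → ∑ (λ x → δ y (φ x)) ≈ 1#
    ∑-δ-φ y =
      ≈.trans (∑-cong (λ x → ≈.trans (≈.reflexive (cong [_] (does-⇔ (y≡φx⇔x≡ψy x y) (y ≟S φ x) (x ≟S ψ y))))
                                     (≈.sym (*-identityˡ _))))
              (∑-δ (λ _ → 1#) (ψ y))

  sumList : List Carrier → Carrier
  sumList = foldr _+_ 0#

  sumList-++ : ∀ xs ys → sumList (xs ++ ys) ≈ sumList xs + sumList ys
  sumList-++ []       ys = ≈.sym (+-identityˡ _)
  sumList-++ (x ∷ xs) ys = ≈.trans (+-cong ≈.refl (sumList-++ xs ys)) (≈.sym (+-assoc _ _ _))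

  sumList-allSubsets : (f : Subset n → Carrier) → sumList (map f (allSubsets n)) ≈ ∑ f
  sumList-allSubsets {zero}  f = +-identityʳ _
  sumList-allSubsets {suc n} f = begin
    sumList (map f (map (inside ∷_) A ++ map (outside ∷_) A))
      ≡⟨ cong sumList (map-++ f (map (inside ∷_) A) _) ⟩
    sumList (map f (map (inside ∷_) A) ++ map f (map (outside ∷_) A))
      ≈⟨ sumList-++ (map f (map (inside ∷_) A)) _ ⟩
    sumList (map f (map (inside ∷_) A)) + sumList (map f (map (outside ∷_) A))
      ≡⟨ cong₂ (λ xs ys → sumList xs + sumList ys) (sym (map-∘ A)) (sym (map-∘ A)) ⟩
    sumList (map (λ x → f (inside ∷ x)) A) + sumList (map (λ x → f (outside ∷ x)) A)
      ≈⟨ +-cong (sumList-allSubsets (λ x → f (inside ∷ x))) (sumList-allSubsets (λ x → f (outside ∷ x))) ⟩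
    ∑ f ∎
    where
    A : List (Subset n)
    A = allSubsets n

  fromℕ-length-filterᵇ : ∀ {A : Set} (p : A → Bool) xs →
                         fromℕ (length (filterᵇ p xs)) ≈ sumList (map (λ x → [ p x ]) xs)
  fromℕ-length-filterᵇ p []       = ≈.refl
  fromℕ-length-filterᵇ p (x ∷ xs) with p x
  ... | true  = +-cong ≈.refl (fromℕ-length-filterᵇ p xs)
  ... | false = ≈.trans (fromℕ-length-filterᵇ p xs) (≈.sym (+-identityˡ _))

  ∑-count : (p : Subset n → Bool) → ∑ (λ x → [ p x ]) ≈ fromℕ (length (filterᵇ p (allSubsets n)))
  ∑-count {n} p = ≈.sym (≈.trans (fromℕ-length-filterᵇ p (allSubsets n)) (sumList-allSubsets (λ x → [ p x ])))

module RingArithmetic {c ℓ : Level} (R : CommutativeRing c ℓ) where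

  open CommutativeRing R hiding (refl; sym; trans; reflexive)
  private module ≈ = CommutativeRing R using (refl; sym; trans)
  open import Algebra.Properties.Ring ring using (-0#≈0#; -‿distribʳ-*)
  open import Algebra.Properties.AbelianGroup +-abelianGroup using (⁻¹-anti-homo‿-)
  open import Algebra.Properties.CommutativeSemigroup *-commutativeSemigroup using (x∙yz≈y∙xz)
  open import Relation.Binary.Reasoning.Setoid setoid

  x-0#≈x : ∀ x → x - 0# ≈ x
  x-0#≈x x = ≈.trans (+-cong ≈.refl -0#≈0#) (+-identityʳ x)

  x-0#*y≈x : ∀ x y → x - 0# * y ≈ x
  x-0#*y≈x x y = ≈.trans (+-cong ≈.refl (-‿cong (zeroˡ y))) (x-0#≈x x)

  x-1#*y≈x-y : ∀ x y → x - 1# * y ≈ x - y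
  x-1#*y≈x-y x y = +-cong ≈.refl (-‿cong (*-identityˡ y))

  [x-z]-[y-z]≈x-y : ∀ x y z → (x - z) - (y - z) ≈ x - y
  [x-z]-[y-z]≈x-y x y z = begin
    (x - z) - (y - z)       ≈⟨ +-cong ≈.refl (⁻¹-anti-homo‿- y z) ⟩
    (x - z) + (z - y)       ≈⟨ +-assoc x (- z) (z - y) ⟩
    x + (- z + (z - y))     ≈⟨ +-cong ≈.refl (+-assoc (- z) z (- y)) ⟨
    x + ((- z + z) - y)     ≈⟨ +-cong ≈.refl (+-cong (-‿inverseˡ z) ≈.refl) ⟩
    x + (0# - y)            ≈⟨ +-cong ≈.refl (+-identityˡ (- y)) ⟩
    x - y                   ∎

  x≈y-z⇒x+z≈y : ∀ {x y z} → x ≈ y - z → x + z ≈ y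
  x≈y-z⇒x+z≈y {x} {y} {z} x≈y-z = begin
    x + z          ≈⟨ +-cong x≈y-z ≈.refl ⟩
    (y - z) + z    ≈⟨ +-assoc y (- z) z ⟩
    y + (- z + z)  ≈⟨ +-cong ≈.refl (-‿inverseˡ z) ⟩
    y + 0#         ≈⟨ +-identityʳ y ⟩
    y              ∎

  x[y-zw]≈xy-z[xw] : ∀ x y z w → x * (y - z * w) ≈ x * y - z * (x * w)
  x[y-zw]≈xy-z[xw] x y z w = begin
    x * (y - z * w)       ≈⟨ distribˡ x y (- (z * w)) ⟩
    x * y + x * - (z * w) ≈⟨ +-cong ≈.refl (-‿distribʳ-* x (z * w)) ⟨
    x * y - x * (z * w)   ≈⟨ +-cong ≈.refl (-‿cong (x∙yz≈y∙xz x z w)) ⟩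
    x * y - z * (x * w)   ∎

module RingSubsetSums {c ℓ : Level} (R : CommutativeRing c ℓ) where

  open CommutativeRing R hiding (refl; sym; trans; reflexive)
  private module ≈ = CommutativeRing R using (refl; sym; trans)
  open SubsetSums commutativeSemiring public
  open import Algebra.Properties.Ring ring using (-‿+-comm)
  open RingArithmetic R using (x[y-zw]≈xy-z[xw])
  open import Relation.Binary.Reasoning.Setoid setoid

  ∑-neg : (f : Subset n → Carrier) → ∑ (λ x → - f x) ≈ - ∑ f
  ∑-neg {zero}  f = ≈.refl
  ∑-neg {suc n} f = ≈.trans (+-cong (∑-neg (λ x → f (inside ∷ x))) (∑-neg (λ x → f (outside ∷ x)))) (-‿+-comm _ _)

  ∑-distrib-- : (f g : Subset n → Carrier) → ∑ (λ x → f x - g x) ≈ ∑ f - ∑ g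
  ∑-distrib-- f g = ≈.trans (∑-distrib-+ f (λ x → - g x)) (+-cong ≈.refl (∑-neg g))

  ∑-δ-combination : (H : Subset n → Carrier) (w₁ w₂ : Subset n) (k : Carrier) →
                    ∑ (λ z → H z * (δ z w₁ - k * δ z w₂)) ≈ H w₁ - k * H w₂
  ∑-δ-combination H w₁ w₂ k = begin
    ∑ (λ z → H z * (δ z w₁ - k * δ z w₂))
      ≈⟨ ∑-cong (λ z → x[y-zw]≈xy-z[xw] (H z) (δ z w₁) k (δ z w₂)) ⟩
    ∑ (λ z → H z * δ z w₁ - k * (H z * δ z w₂))
      ≈⟨ ∑-distrib-- (λ z → H z * δ z w₁) (λ z → k * (H z * δ z w₂)) ⟩
    ∑ (λ z → H z * δ z w₁) - ∑ (λ z → k * (H z * δ z w₂))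
      ≈⟨ +-cong (∑-δ H w₁) (-‿cong (≈.sym (*-distribˡ-∑ k (λ z → H z * δ z w₂)))) ⟩
    H w₁ - k * ∑ (λ z → H z * δ z w₂)
      ≈⟨ +-cong ≈.refl (-‿cong (*-cong ≈.refl (∑-δ H w₂))) ⟩
    H w₁ - k * H w₂
      ∎

-- Fixed-point counts of invariant families

isFixed : Map n → Subset n → Bool
isFixed g σ = ⌊ act g σ ≟S σ ⌋

fixedCount : (Subset n → Bool) → Map n → ℕ
fixedCount {n} P g = length (filterᵇ (λ σ → P σ ∧ isFixed g σ) (allSubsets n))

module ℕSums = SubsetSums +-*-commutativeSemiring

length-filterᵇ≡∑ : (p : Subset n → Bool) → length (filterᵇ p (allSubsets n)) ≡ ℕSums.∑ (λ σ → ℕSums.[ p σ ])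
length-filterᵇ≡∑ p = sym (trans (ℕSums.∑-count p) (fromℕ≡id _))
  where
  fromℕ≡id : ∀ k → ℕSums.fromℕ k ≡ k
  fromℕ≡id zero    = refl
  fromℕ≡id (suc k) = cong suc (fromℕ≡id k)

module _ {n D : ℕ} {C : BalancedRelComplex n D} (G : AutSubgroup C) where

  open AutSubgroup G

  IsInvariant : (Subset n → Bool) → Set
  IsInvariant P = ∀ g → T (mem g) → ∀ σ → T (P σ) → T (P (act g σ))

  act-inverseʳ : ∀ h h′ → T (mem h′) → h′ ∘M h ≡ idMap → ∀ σ → act h (act h′ σ) ≡ σ
  act-inverseʳ h h′ h′∈G h′∘h≡id σ with inv∈ h′ h′∈G
  ... | h″ , _ , h″∘h′≡id = begin
    act h (act h′ σ)                        ≡⟨ act-inverse h′ h″ h″∘h′≡id (act h (act h′ σ)) ⟨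
    act h″ (act h′ (act h (act h′ σ)))      ≡⟨ cong (act h″) (act-inverse h h′ h′∘h≡id (act h′ σ)) ⟩
    act h″ (act h′ σ)                       ≡⟨ act-inverse h′ h″ h″∘h′≡id σ ⟩
    σ                                       ∎
    where open ≡-Reasoning

  invariant-≡ : ∀ {P} → IsInvariant P → ∀ g → T (mem g) → ∀ σ → P (act g σ) ≡ P σ
  invariant-≡ {P} P-inv g g∈G σ with inv∈ g g∈G
  ... | h , h∈G , h∘g≡id =
    T⇔T⇒≡ (λ P[gσ] → subst (T ∘ P) (act-inverse g h h∘g≡id σ) (P-inv h h∈G (act g σ) P[gσ])) (P-inv g g∈G σ)

  fixedCount-isClassFunction : ∀ {P} → IsInvariant P → IsClassFunction G (fixedCount P)
  fixedCount-isClassFunction {P} P-inv g h h′ g∈G h∈G h′∈G h′∘h≡id = begin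
    fixedCount P k                                      ≡⟨ length-filterᵇ≡∑ (λ σ → P σ ∧ isFixed k σ) ⟩
    ∑ (λ σ → [ P σ ∧ isFixed k σ ])                     ≡⟨ ∑-cong (λ σ → cong [_] (conjugate σ)) ⟩
    ∑ (λ σ → [ P (act h′ σ) ∧ isFixed g (act h′ σ) ])
      ≡⟨ ∑-reindex (act h′) (act h) (act-inverseʳ h h′ h′∈G h′∘h≡id) (act-inverse h h′ h′∘h≡id)
                   (λ σ → [ P σ ∧ isFixed g σ ]) ⟩
    ∑ (λ σ → [ P σ ∧ isFixed g σ ])                     ≡⟨ length-filterᵇ≡∑ (λ σ → P σ ∧ isFixed g σ) ⟨
    fixedCount P g                                      ∎
    where
    open ≡-Reasoning
    open ℕSums using (∑; [_]; ∑-cong; ∑-reindex)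
    k : Map n
    k = h ∘M (g ∘M h′)
    act-k : ∀ σ → act k σ ≡ act h (act g (act h′ σ))
    act-k σ = trans (act-∘M h (g ∘M h′) σ) (cong (act h) (act-∘M g h′ σ))
    conjugate : ∀ σ → P σ ∧ isFixed k σ ≡ P (act h′ σ) ∧ isFixed g (act h′ σ)
    conjugate σ =
      cong₂ _∧_ (sym (invariant-≡ P-inv h′ h′∈G σ)) (⌊⌋-⇔ (mk⇔ to from) (act k σ ≟S σ) (act g τ ≟S τ))
      where
      τ : Subset n
      τ = act h′ σ
      to : act k σ ≡ σ → act g τ ≡ τ
      to kσ≡σ = trans (sym (act-inverse h h′ h′∘h≡id (act g τ))) (cong (act h′) (trans (sym (act-k σ)) kσ≡σ))
      from : act g τ ≡ τ → act k σ ≡ σ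
      from gτ≡τ = trans (act-k σ) (trans (cong (act h) gτ≡τ) (act-inverseʳ h h′ h′∈G h′∘h≡id σ))

-- The kernel of an equivariant surjection of permutation modules

-- π, restricted to P, induces the 𝔊-map K[P] → K[Q], e_x ↦ [Q (π x)] e_{π x}, and s is a
-- set-theoretic section of it. Its kernel has the basis b_x = e_x − [Q (π x)] e_{s (π x)}, where x
-- ranges over the x ∈ P with ¬ Q (π x) or x ≢ s (π x); ρ g is the matrix of g in this basis.
module KernelRepresentation
  {c ℓ : Level} (K : AlgClosedChar0Field c ℓ)
  {n D : ℕ} {C : BalancedRelComplex n D} (G : AutSubgroup C)
  (P Q : Subset n → Bool) (π s : Subset n → Subset n)
  (P-invariant : IsInvariant G P) (Q-invariant : IsInvariant G Q)
  (π-equivariant : ∀ g → T (AutSubgroup.mem G g) → ∀ x → T (P x) → π (act g x) ≡ act g (π x))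
  (s-into-P : ∀ y → T (Q y) → T (P (s y)))
  (π∘s : ∀ y → T (Q y) → π (s y) ≡ y)
  where

  open AutSubgroup G
  open AlgClosedChar0Field K hiding (refl; sym; trans; reflexive)
  private module ≈ = AlgClosedChar0Field K using (refl; sym; trans; reflexive)
  open RingSubsetSums cring
  open RingArithmetic cring
  open import Relation.Binary.Reasoning.Setoid setoid

  hasPartner : Subset n → Bool
  hasPartner x = Q (π x)

  partner : Subset n → Subset n
  partner x = s (π x)

  isRepresentative : Subset n → Bool
  isRepresentative x = hasPartner x ∧ ⌊ partner x ≟S x ⌋

  inBasis : Subset n → Bool
  inBasis x = P x ∧ not (isRepresentative x)

  basis : List (Subset n)
  basis = filterᵇ inBasis (allSubsets n)

  entry : Map n → Subset n → Subset n → Carrier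
  entry g a x = δ a (act g x) - [ hasPartner x ] * δ a (act g (partner x))

  ρ : Map n → Mat K (length basis)
  ρ g i j = entry g (List.lookup basis i) (List.lookup basis j)

  entry-with : ∀ g a x {b} → hasPartner x ≡ b → entry g a x ≡ δ a (act g x) - [ b ] * δ a (act g (partner x))
  entry-with g a x refl = refl

  entry-noPartner : ∀ g a x → hasPartner x ≡ false → entry g a x ≈ δ a (act g x)
  entry-noPartner g a x e = ≈.trans (≈.reflexive (entry-with g a x e)) (x-0#*y≈x _ _)

  entry-partner : ∀ g a x → hasPartner x ≡ true → entry g a x ≈ δ a (act g x) - δ a (act g (partner x))
  entry-partner g a x e = ≈.trans (≈.reflexive (entry-with g a x e)) (x-1#*y≈x-y _ _)

  entry-representative : ∀ g a w → T (isRepresentative w) → entry g a w ≈ 0#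
  entry-representative g a w rep with Equivalence.to T-∧ rep
  ... | hasPartner-w , partner-w≡w = begin
    entry g a w                                ≈⟨ entry-partner g a w (Equivalence.to T-≡ hasPartner-w) ⟩
    δ a (act g w) - δ a (act g (partner w))    ≡⟨ cong (λ y → δ a (act g w) - δ a (act g y)) (toWitness partner-w≡w) ⟩
    δ a (act g w) - δ a (act g w)              ≈⟨ -‿inverseʳ _ ⟩
    0#                                         ∎

  basis-weight : ∀ g a x → [ P x ∧ not (isRepresentative x) ] * entry g a x ≈ [ P x ] * entry g a x
  basis-weight g a x with P x | isRepresentative x in rep
  ... | false | _     = ≈.refl
  ... | true  | false = ≈.refl
  ... | true  | true  =
    ≈.trans (zeroˡ _) (≈.sym (≈.trans (*-identityˡ _) (entry-representative g a x (Equivalence.from T-≡ rep))))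

  hasPartner-act : ∀ h → T (mem h) → ∀ x → T (P x) → hasPartner (act h x) ≡ hasPartner x
  hasPartner-act h h∈G x Px = trans (cong Q (π-equivariant h h∈G x Px)) (invariant-≡ G Q-invariant h h∈G (π x))

  π-partner-act : ∀ h → T (mem h) → ∀ x → T (hasPartner x) → π (act h (partner x)) ≡ act h (π x)
  π-partner-act h h∈G x Qπx = trans (π-equivariant h h∈G (partner x) (s-into-P (π x) Qπx)) (cong (act h) (π∘s (π x) Qπx))

  entry-∘M : ∀ g h a x → T (mem h) → T (P x) →
             entry g a (act h x) - [ hasPartner x ] * entry g a (act h (partner x)) ≈ entry (g ∘M h) a x
  entry-∘M g h a x h∈G Px = by-cases (hasPartner x) refl
    where
    by-cases : ∀ b → hasPartner x ≡ b →
               entry g a (act h x) - [ b ] * entry g a (act h (partner x)) ≈ entry (g ∘M h) a x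
    by-cases false e = begin
      entry g a (act h x) - 0# * entry g a (act h (partner x))  ≈⟨ x-0#*y≈x _ _ ⟩
      entry g a (act h x)                                       ≈⟨ entry-noPartner g a (act h x) (trans (hasPartner-act h h∈G x Px) e) ⟩
      δ a (act g (act h x))                                     ≡⟨ cong (δ a) (act-∘M g h x) ⟨
      δ a (act (g ∘M h) x)                                      ≈⟨ entry-noPartner (g ∘M h) a x e ⟨
      entry (g ∘M h) a x                                        ∎
    by-cases true e = begin
      entry g a w₁ - 1# * entry g a w₂                          ≈⟨ x-1#*y≈x-y _ _ ⟩
      entry g a w₁ - entry g a w₂
        ≈⟨ +-cong (entry-partner g a w₁ hasPartner-w₁) (-‿cong (entry-partner g a w₂ hasPartner-w₂)) ⟩
      (δ a (act g w₁) - δ a (act g (partner w₁))) - (δ a (act g w₂) - δ a (act g (partner w₂)))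
        ≡⟨ cong (λ y → (δ a (act g w₁) - δ a (act g (partner w₁))) - (δ a (act g w₂) - δ a (act g (s y)))) π-w₂≡π-w₁ ⟩
      (δ a (act g w₁) - δ a (act g (partner w₁))) - (δ a (act g w₂) - δ a (act g (partner w₁)))
        ≈⟨ [x-z]-[y-z]≈x-y _ _ _ ⟩
      δ a (act g w₁) - δ a (act g w₂)
        ≡⟨ cong₂ (λ u v → δ a u - δ a v) (act-∘M g h x) (act-∘M g h (partner x)) ⟨
      δ a (act (g ∘M h) x) - δ a (act (g ∘M h) (partner x))     ≈⟨ entry-partner (g ∘M h) a x e ⟨
      entry (g ∘M h) a x                                        ∎
      where
      w₁ w₂ : Subset n
      w₁ = act h x
      w₂ = act h (partner x)
      π-w₂≡π-w₁ : π w₂ ≡ π w₁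
      π-w₂≡π-w₁ = trans (π-partner-act h h∈G x (Equivalence.from T-≡ e)) (sym (π-equivariant h h∈G x Px))
      hasPartner-w₁ : hasPartner w₁ ≡ true
      hasPartner-w₁ = trans (hasPartner-act h h∈G x Px) e
      hasPartner-w₂ : hasPartner w₂ ≡ true
      hasPartner-w₂ = trans (cong Q π-w₂≡π-w₁) hasPartner-w₁

  sumF-filterᵇ : (p : Subset n → Bool) (F : Subset n → Carrier) (xs : List (Subset n)) →
                 sumF K (λ i → F (List.lookup (filterᵇ p xs) i)) ≈ sumList (map (λ x → [ p x ] * F x) xs)
  sumF-filterᵇ p F []       = ≈.refl
  sumF-filterᵇ p F (x ∷ xs) with p x
  ... | true  = +-cong (≈.sym (*-identityˡ _)) (sumF-filterᵇ p F xs)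
  ... | false = ≈.trans (sumF-filterᵇ p F xs) (≈.sym (≈.trans (+-cong (zeroˡ _) ≈.refl) (+-identityˡ _)))

  sumF-basis : (F : Subset n → Carrier) → sumF K (λ i → F (List.lookup basis i)) ≈ ∑ (λ x → [ inBasis x ] * F x)
  sumF-basis F = ≈.trans (sumF-filterᵇ inBasis F (allSubsets n)) (sumList-allSubsets (λ x → [ inBasis x ] * F x))

  basis-inBasis : ∀ i → T (inBasis (List.lookup basis i))
  basis-inBasis i = proj₂ (∈-filter⁻ (T? ∘ inBasis) {xs = allSubsets n} (∈-lookup {xs = basis} i))

  basis-P : ∀ i → T (P (List.lookup basis i))
  basis-P i = proj₁ (Equivalence.to T-∧ (basis-inBasis i))

  basis-injective : ∀ i j → List.lookup basis i ≡ List.lookup basis j → i ≡ j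
  basis-injective = Unique-lookup-injective (filter⁺ (T? ∘ inBasis) (allSubsets-unique n))

  weighted-entry : ∀ g a w → T (P w) → [ inBasis w ] * entry g a w ≈ entry g a w
  weighted-entry g a w Pw = ≈.trans (basis-weight g a w) (≈.trans (*-cong ([T] Pw) ≈.refl) (*-identityˡ _))

  ρ-hom : ∀ g h → T (mem h) → ∀ i j → ρ (g ∘M h) i j ≈ sumF K (λ k → ρ g i k * ρ h k j)
  ρ-hom g h h∈G i j = begin
    entry (g ∘M h) a x                                        ≈⟨ entry-∘M g h a x h∈G Px ⟨
    entry g a w₁ - [ hasPartner x ] * entry g a w₂
      ≈⟨ +-cong (weighted-entry g a w₁ (P-invariant h h∈G x Px)) (-‿cong partner-term) ⟨
    H w₁ - [ hasPartner x ] * H w₂                            ≈⟨ ∑-δ-combination H w₁ w₂ [ hasPartner x ] ⟨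
    ∑ (λ z → H z * entry h z x)                               ≈⟨ ∑-cong (λ z → *-assoc [ inBasis z ] (entry g a z) (entry h z x)) ⟩
    ∑ (λ z → [ inBasis z ] * (entry g a z * entry h z x))     ≈⟨ sumF-basis (λ z → entry g a z * entry h z x) ⟨
    sumF K (λ k → ρ g i k * ρ h k j)                          ∎
    where
    a x w₁ w₂ : Subset n
    a = List.lookup basis i
    x = List.lookup basis j
    w₁ = act h x
    w₂ = act h (partner x)
    Px : T (P x)
    Px = basis-P j
    H : Subset n → Carrier
    H z = [ inBasis z ] * entry g a z
    partner-term : [ hasPartner x ] * H w₂ ≈ [ hasPartner x ] * entry g a w₂
    partner-term = []-*-cong (hasPartner x) λ Qπx →
      weighted-entry g a w₂ (P-invariant h h∈G (partner x) (s-into-P (π x) Qπx))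

  partner-isRepresentative : ∀ x → T (hasPartner x) → T (isRepresentative (partner x))
  partner-isRepresentative x Qπx =
    subst T (cong (λ y → Q y ∧ ⌊ s y ≟S partner x ⌋) (sym (π∘s (π x) Qπx)))
            (Equivalence.from T-∧ (Qπx , fromWitness refl))

  inBasis-≢-partner : ∀ a x → T (inBasis a) → T (hasPartner x) → a ≢ partner x
  inBasis-≢-partner a x a∈ Qπx refl =
    T-not⇒¬T (proj₂ (Equivalence.to T-∧ a∈)) (partner-isRepresentative x Qπx)

  ρ-idMap : ∀ i j → ρ idMap i j ≈ idMat K i j
  ρ-idMap i j = begin
    entry idMap a x
      ≡⟨ cong₂ (λ u v → δ a u - [ hasPartner x ] * δ a v) (act-idMap x) (act-idMap (partner x)) ⟩
    δ a x - [ hasPartner x ] * δ a (partner x)       ≈⟨ +-cong ≈.refl (-‿cong partner-term) ⟩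
    δ a x - 0#                                       ≈⟨ x-0#≈x (δ a x) ⟩
    δ a x                                            ≡⟨ cong [_] a≟x≡i≟j ⟩
    idMat K i j                                      ∎
    where
    a x : Subset n
    a = List.lookup basis i
    x = List.lookup basis j
    partner-term : [ hasPartner x ] * δ a (partner x) ≈ 0#
    partner-term = ≈.trans ([]-*-cong (hasPartner x) λ Qπx → ≈.reflexive (δ-≢ (inBasis-≢-partner a x (basis-inBasis i) Qπx)))
                           (zeroʳ _)
    a≟x≡i≟j : does (a ≟S x) ≡ ⌊ i Fin.≟ j ⌋
    a≟x≡i≟j = trans (does-⇔ (mk⇔ (basis-injective i j) (cong (List.lookup basis))) (a ≟S x) (i Fin.≟ j))
                    (sym (isYes≗does (i Fin.≟ j)))

  ∑-count-fixed : ∀ (R : Subset n → Bool) g → ∑ (λ x → [ R x ∧ isFixed g x ]) ≈ ι (fixedCount R g)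
  ∑-count-fixed R g = ≈.trans (∑-count (λ x → R x ∧ isFixed g x)) (fromℕ≈ι (fixedCount R g))
    where
    fromℕ≈ι : ∀ k → fromℕ k ≈ ι k
    fromℕ≈ι zero    = ≈.refl
    fromℕ≈ι (suc k) = +-cong ≈.refl (fromℕ≈ι k)

  ∑-fixed : ∀ g → ∑ (λ x → [ P x ] * δ x (act g x)) ≈ ι (fixedCount P g)
  ∑-fixed g = ≈.trans (∑-cong weight) (∑-count-fixed P g)
    where
    weight : ∀ x → [ P x ] * δ x (act g x) ≈ [ P x ∧ isFixed g x ]
    weight x = ≈.trans (*-cong ≈.refl (≈.reflexive (δ≡[⌊≟S⌋] x (act g x)))) (≈.sym ([∧] (P x) (isFixed g x)))

  ∑-fixed-partners : ∀ g → T (mem g) →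
    ∑ (λ x → [ hasPartner x ] * ([ P x ] * δ x (act g (partner x)))) ≈ ι (fixedCount Q g)
  ∑-fixed-partners g g∈G = begin
    ∑ (λ x → [ Q (π x) ] * ([ P x ] * δ x (act g (s (π x)))))
      ≈⟨ ∑-cong (λ x → ≈.sym (*-assoc [ Q (π x) ] [ P x ] (δ x (act g (s (π x)))))) ⟩
    ∑ (λ x → F x (π x))                                      ≈⟨ ∑-cong (λ x → ∑-δ (F x) (π x)) ⟨
    ∑ (λ x → ∑ (λ y → F x y * δ y (π x)))                    ≈⟨ ∑-comm (λ x y → F x y * δ y (π x)) ⟩
    ∑ (λ y → ∑ (λ x → F x y * δ y (π x)))
      ≈⟨ ∑-cong (λ y → ∑-cong (λ x → xy∙z≈xz∙y ([ Q y ] * [ P x ]) (δ x (act g (s y))) (δ y (π x)))) ⟩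
    ∑ (λ y → ∑ (λ x → E y x * δ x (act g (s y))))            ≈⟨ ∑-cong (λ y → ∑-δ (E y) (act g (s y))) ⟩
    ∑ (λ y → E y (act g (s y)))                              ≈⟨ ∑-cong E-at-image ⟩
    ∑ (λ y → [ Q y ∧ isFixed g y ])                          ≈⟨ ∑-count-fixed Q g ⟩
    ι (fixedCount Q g)                                       ∎
    where
    open import Algebra.Properties.CommutativeSemigroup *-commutativeSemigroup using (xy∙z≈xz∙y)
    F : Subset n → Subset n → Carrier
    F x y = ([ Q y ] * [ P x ]) * δ x (act g (s y))
    E : Subset n → Subset n → Carrier
    E y x = ([ Q y ] * [ P x ]) * δ y (π x)
    E-at-image : ∀ y → E y (act g (s y)) ≈ [ Q y ∧ isFixed g y ]
    E-at-image y with Q y in Qy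
    ... | false = ≈.trans (*-cong (zeroˡ _) ≈.refl) (zeroˡ _)
    ... | true  = begin
      (1# * [ P (act g (s y)) ]) * δ y (π (act g (s y)))   ≈⟨ *-cong (≈.trans (*-identityˡ _) ([T] P-gsy)) ≈.refl ⟩
      1# * δ y (π (act g (s y)))                            ≈⟨ *-identityˡ _ ⟩
      δ y (π (act g (s y)))                                 ≡⟨ cong (δ y) π-gsy ⟩
      δ y (act g y)                                         ≡⟨ δ≡[⌊≟S⌋] y (act g y) ⟩
      [ isFixed g y ]                                       ∎
      where
      Q-y : T (Q y)
      Q-y = Equivalence.from T-≡ Qy
      P-gsy : T (P (act g (s y)))
      P-gsy = P-invariant g g∈G (s y) (s-into-P y Q-y)
      π-gsy : π (act g (s y)) ≡ act g y
      π-gsy = trans (π-equivariant g g∈G (s y) (s-into-P y Q-y)) (cong (act g) (π∘s y Q-y))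

  ρ-trace : ∀ g → T (mem g) → trace K (ρ g) + ι (fixedCount Q g) ≈ ι (fixedCount P g)
  ρ-trace g g∈G = x≈y-z⇒x+z≈y (begin
    sumF K (λ i → entry g (List.lookup basis i) (List.lookup basis i))  ≈⟨ sumF-basis (λ x → entry g x x) ⟩
    ∑ (λ x → [ inBasis x ] * entry g x x)                               ≈⟨ ∑-cong (λ x → basis-weight g x x) ⟩
    ∑ (λ x → [ P x ] * entry g x x)
      ≈⟨ ∑-cong (λ x → x[y-zw]≈xy-z[xw] [ P x ] (δ x (act g x)) [ hasPartner x ] (δ x (act g (partner x)))) ⟩
    ∑ (λ x → [ P x ] * δ x (act g x) - [ hasPartner x ] * ([ P x ] * δ x (act g (partner x))))
      ≈⟨ ∑-distrib-- (λ x → [ P x ] * δ x (act g x)) (λ x → [ hasPartner x ] * ([ P x ] * δ x (act g (partner x)))) ⟩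
    ∑ (λ x → [ P x ] * δ x (act g x)) - ∑ (λ x → [ hasPartner x ] * ([ P x ] * δ x (act g (partner x))))
      ≈⟨ +-cong (∑-fixed g) (-‿cong (∑-fixed-partners g g∈G)) ⟩
    ι (fixedCount P g) - ι (fixedCount Q g)                             ∎)

  fixedCount-≤G : ≤G K G (fixedCount Q) (fixedCount P)
  fixedCount-≤G =
    record { dim = length basis ; ρ = ρ ; ρ-id = ρ-idMap ; ρ-hom = λ g h _ h∈G → ρ-hom g h h∈G } , ρ-trace

≤G-resp-≗ : ∀ {c ℓ} (K : AlgClosedChar0Field c ℓ) {n D} {C : BalancedRelComplex n D} {G : AutSubgroup C}
            {χ χ′ ψ ψ′ : Map n → ℕ} → (∀ g → χ g ≡ χ′ g) → (∀ g → ψ g ≡ ψ′ g) → ≤G K G χ ψ → ≤G K G χ′ ψ′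
≤G-resp-≗ K χ≗χ′ ψ≗ψ′ (R , tr) = R , λ g g∈G →
  subst₂ (λ a b → trace K (Rep.ρ R g) + ι a ≈ ι b) (χ≗χ′ g) (ψ≗ψ′ g) (tr g g∈G)
  where open AlgClosedChar0Field K using (_+_; _≈_; ι)

-- Faces of a given type

_≟ₗ_ : DecidableEquality (List ℕ)
_≟ₗ_ = ListP.≡-dec _≟ℕ_

module Faces {n D : ℕ} (C : BalancedRelComplex n D) (G : AutSubgroup C) where

  open BalancedRelComplex C
  open AutSubgroup G

  colours : Subset n → Subset D
  colours = image κ

  ofType : List ℕ → Subset n → Bool
  ofType γ σ = Φ σ ∧ ⌊ α (colours σ) ≟ₗ γ ⌋

  flagCoeff≡fixedCount : ∀ γ g → flagCoeff C γ g ≡ fixedCount (ofType γ) g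
  flagCoeff≡fixedCount γ g = length-filterᵇ-cong reorder (allSubsets n)
    where
    reorder : ∀ σ → Φ σ ∧ (isFixed g σ ∧ ⌊ α (colours σ) ≟ₗ γ ⌋) ≡ ofType γ σ ∧ isFixed g σ
    reorder σ = trans (cong (Φ σ ∧_) (∧-comm (isFixed g σ) _)) (sym (∧-assoc (Φ σ) _ (isFixed g σ)))

  colours-act : ∀ g → T (mem g) → ∀ σ → colours (act g σ) ≡ colours σ
  colours-act g g∈G σ = trans (image-∘ κ (lookup g) σ) (image-cong (colour g g∈G) σ)

  ofType-invariant : ∀ γ → IsInvariant G (ofType γ)
  ofType-invariant γ g g∈G σ σ∈ with Equivalence.to T-∧ σ∈
  ... | Φσ , αγ =
    Equivalence.from T-∧ (preserve g g∈G σ Φσ , subst (λ S → T ⌊ α S ≟ₗ γ ⌋) (sym (colours-act g g∈G σ)) αγ)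

  ofType⇒α≡ : ∀ γ y → T (ofType γ y) → α (colours y) ≡ γ
  ofType⇒α≡ γ y y∈ = toWitness {a? = α (colours y) ≟ₗ γ} (proj₂ (Equivalence.to (T-∧ {Φ y}) y∈))

  flagCoeff-isClassFunction : ∀ γ → IsClassFunction G (flagCoeff C γ)
  flagCoeff-isClassFunction γ g h h′ g∈G h∈G h′∈G h′∘h≡id =
    trans (flagCoeff≡fixedCount γ (h ∘M (g ∘M h′)))
          (trans (fixedCount-isClassFunction G (ofType-invariant γ) g h h′ g∈G h∈G h′∈G h′∘h≡id)
                 (sym (flagCoeff≡fixedCount γ g)))

  -- For y ∉ Φ, facet y is the junk value y.
  facet : Subset n → Subset n
  facet y with T? (Φ y)
  ... | yes Φy = proj₁ (pure y Φy)
  ... | no _   = y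

  facet-spec : ∀ y → T (Φ y) → y ⊆ facet y × T (Φ (facet y)) × ∣ facet y ∣ ≡ D
  facet-spec y Φy with T? (Φ y)
  ... | yes Φy′ = proj₂ (pure y Φy′)
  ... | no ¬Φy  = contradiction Φy ¬Φy

  colours-facet : ∀ y → T (Φ y) → colours (facet y) ≡ ⊤
  colours-facet y Φy with facet-spec y Φy
  ... | _ , Φ-facet , ∣facet∣≡D = ∣p∣≡n⇒p≡⊤ (trans (balanced (facet y) Φ-facet) ∣facet∣≡D)

  module Extension {U V : Subset D} (U⊆V : U ⊆ V) where

    restrict : Subset n → Subset n
    restrict σ = σ ∩ preimage κ U

    extend : Subset n → Subset n
    extend y = y ∪ (facet y ∩ preimage κ (V ∩ ∁ U))

    restrict-equivariant : ∀ g → T (mem g) → ∀ σ → restrict (act g σ) ≡ act g (restrict σ)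
    restrict-equivariant g g∈G σ = sym (image-∩-preimage κ (colour g g∈G) σ U)

    ⊆-extend : ∀ y → y ⊆ extend y
    ⊆-extend y v∈y = x∈p∪q⁺ (inj₁ v∈y)

    extend-⊆-facet : ∀ y → T (Φ y) → extend y ⊆ facet y
    extend-⊆-facet y Φy v∈ with x∈p∪q⁻ y _ v∈
    ... | inj₁ v∈y = proj₁ (facet-spec y Φy) v∈y
    ... | inj₂ v∈F = proj₁ (x∈p∩q⁻ (facet y) _ v∈F)

    extend-Φ : ∀ y → T (Φ y) → T (Φ (extend y))
    extend-Φ y Φy = convex y (extend y) (facet y) (⊆-extend y) (extend-⊆-facet y Φy) Φy (proj₁ (proj₂ (facet-spec y Φy)))

    colours-extend : ∀ y → T (Φ y) → colours y ≡ U → colours (extend y) ≡ V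
    colours-extend y Φy colours-y≡U = ⊆-antisym sub sup
      where
      sub : colours (extend y) ⊆ V
      sub c∈ with ∈-image⁻ κ {extend y} c∈
      ... | v , v∈ , refl with x∈p∪q⁻ y _ v∈
      ...   | inj₁ v∈y = U⊆V (subst (κ v ∈_) colours-y≡U (∈-image⁺ κ {y} v∈y))
      ...   | inj₂ v∈F = proj₁ (x∈p∩q⁻ V _ (∈-preimage⁻ (proj₂ (x∈p∩q⁻ (facet y) _ v∈F))))
      sup : V ⊆ colours (extend y)
      sup {c} c∈V with c ∈? U
      ... | yes c∈U with ∈-image⁻ κ {y} (subst (c ∈_) (sym colours-y≡U) c∈U)
      ...   | v , v∈y , refl = ∈-image⁺ κ {extend y} (⊆-extend y v∈y)
      sup {c} c∈V | no c∉U with ∈-image⁻ κ {facet y} (subst (c ∈_) (sym (colours-facet y Φy)) ∈⊤)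
      ...   | v , v∈F , refl =
        ∈-image⁺ κ {extend y} (x∈p∪q⁺ (inj₂ (x∈p∩q⁺ (v∈F , ∈-preimage⁺ (x∈p∩q⁺ (c∈V , x∉p⇒x∈∁p c∉U))))))

    restrict-extend : ∀ y → colours y ≡ U → restrict (extend y) ≡ y
    restrict-extend y colours-y≡U = ⊆-antisym sub sup
      where
      sub : restrict (extend y) ⊆ y
      sub v∈ with x∈p∩q⁻ (extend y) _ v∈
      ... | v∈ext , v∈κ⁻¹U with x∈p∪q⁻ y _ v∈ext
      ...   | inj₁ v∈y = v∈y
      ...   | inj₂ v∈F = contradiction (∈-preimage⁻ v∈κ⁻¹U)
                           (x∈∁p⇒x∉p (proj₂ (x∈p∩q⁻ V _ (∈-preimage⁻ (proj₂ (x∈p∩q⁻ (facet y) _ v∈F))))))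
      sup : y ⊆ restrict (extend y)
      sup {v} v∈y = x∈p∩q⁺ (⊆-extend y v∈y , ∈-preimage⁺ (subst (κ v ∈_) colours-y≡U (∈-image⁺ κ {y} v∈y)))

    extend-ofType : ∀ y → T (ofType (α U) y) → T (ofType (α V) (extend y))
    extend-ofType y y∈ = Equivalence.from T-∧ (extend-Φ y Φy , fromWitness (cong α (colours-extend y Φy colours-y≡U)))
      where
      Φy : T (Φ y)
      Φy = proj₁ (Equivalence.to T-∧ y∈)
      colours-y≡U : colours y ≡ U
      colours-y≡U = α-injective (ofType⇒α≡ (α U) y y∈)

    restrict-extend-ofType : ∀ y → T (ofType (α U) y) → restrict (extend y) ≡ y
    restrict-extend-ofType y y∈ = restrict-extend y (α-injective (ofType⇒α≡ (α U) y y∈))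

  module _ {c ℓ : Level} (K : AlgClosedChar0Field c ℓ) where

    fixedCount-ofType-⊆ : ∀ {U V} → U ⊆ V → ≤G K G (fixedCount (ofType (α U))) (fixedCount (ofType (α V)))
    fixedCount-ofType-⊆ {U} {V} U⊆V =
      KernelRepresentation.fixedCount-≤G K G (ofType (α V)) (ofType (α U)) restrict extend
        (ofType-invariant (α V)) (ofType-invariant (α U)) (λ g g∈G σ _ → restrict-equivariant g g∈G σ)
        extend-ofType restrict-extend-ofType
      where open Extension U⊆V

    fixedCount-ofType-unrealised : ∀ {γ P} → (∀ U → α U ≢ γ) → IsInvariant G P →
                                   ≤G K G (fixedCount (ofType γ)) (fixedCount P)
    fixedCount-ofType-unrealised {γ} {P} ∄U P-invariant =
      KernelRepresentation.fixedCount-≤G K G P (ofType γ) id id P-invariant (ofType-invariant γ)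
        (λ _ _ _ _ → refl) (λ y y∈ → contradiction (ofType⇒α≡ γ y y∈) (∄U (colours y))) (λ _ _ → refl)

    fixedCount-ofType-increasing : ∀ γ β → IsComposition β → β Refines γ →
                                   ≤G K G (fixedCount (ofType γ)) (fixedCount (ofType β))
    fixedCount-ofType-increasing γ β β-comp β≼γ with anySubset? (λ U → α U ≟ₗ γ)
    ... | no ∄U = fixedCount-ofType-unrealised (λ U αU≡γ → ∄U (U , αU≡γ)) (ofType-invariant β)
    ... | yes (U , refl) with Refines-gapsOf U β-comp (subst (β Refines_) (α≡gapsOf U) β≼γ)
    ...   | V , refl = subst (λ β → ≤G K G (fixedCount (ofType (α U))) (fixedCount (ofType β))) (α≡gapsOf V)
                         (fixedCount-ofType-⊆ (Refines⇒⊆ U V (subst (gapsOf V Refines_) (α≡gapsOf U) β≼γ)))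

    flagCoeff-increasing : ∀ γ β → IsComposition β → β Refines γ → ≤G K G (flagCoeff C γ) (flagCoeff C β)
    flagCoeff-increasing γ β β-comp β≼γ =
      ≤G-resp-≗ K (sym ∘ flagCoeff≡fixedCount γ) (sym ∘ flagCoeff≡fixedCount β)
                (fixedCount-ofType-increasing γ β β-comp β≼γ)

-- The hypothesis that γ is a composition is unused: it follows from the other two.
theorem8 : {c ℓ : Level} (K : AlgClosedChar0Field c ℓ)
    {n D : ℕ} (C : BalancedRelComplex n D) (G : AutSubgroup C) →
    ((γ : List ℕ) → IsClassFunction G (flagCoeff C γ))
    × ((γ β : List ℕ) → IsComposition γ → IsComposition β → β Refines γ →
         ≤G K G (flagCoeff C γ) (flagCoeff C β))
theorem8 K C G = flagCoeff-isClassFunction , λ γ β _ β-comp → flagCoeff-increasing K γ β β-comp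
  where open Faces C G
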